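{- Let $A$ be a finite set of alternatives, let $\mathcal D\subseteq\mathcal L(A)$ be a peak-pit Condorcet domain, let $R,T\in\mathcal D$, and let $B\subseteq A$ with $|B|\ge 3$. Then there exists a geodesic $\mathcal A=(R_1,\dots,R_k)$ of alike linear orders in $\mathcal L(B)$ connecting $R_B$ and $T_B$ such that $\mathcal D_B\cup\{R_1,\dots,R_k\}$ is a peak-pit Condorcet domain (on $B$).
   Context: $\mathcal L(A)$ is the set of linear orders on $A$, written as words from top to bottom; $R_B$ is the restriction of $R$ to $B$ and $\mathcal D_B=\{R_B:R\in\mathcal D\}$. For distinct $a,b,c$, $x\in\{a,b,c\}$, $k\in\{1,2,3\}$, a domain satisfies the never-condition $xN_{\{a,b,c\}}k$ if none of its orders restricted to $\{a,b,c\}$ has $x$ in position $k$. A domain is a peak-pit Condorcet domain if for every triple of distinct alternatives its restriction to that triple satisfies some never-condition with $k=1$ (never-top) or $k=3$ (never-bottom). Two linear orders are alike if they differ by swapping two alternatives in adjacent positions. A path of alike linear orders connecting $R$ and $T$ is a sequence $(R_1,\dots,R_k)$ with $R_1=R$, $R_k=T$ and consecutive orders alike; a geodesic is such a path with minimum possible $k$. -}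

module Defs where

open import Data.Nat using (ℕ; zero; suc; _≤_)
open import Data.Fin using (Fin)
open import Data.Fin.Properties using (_≟_)
open import Data.Fin.Subset using (Subset; ∣_∣; ⊤) renaming (_∈_ to _∈ₛ_)
open import Data.Fin.Subset.Properties using () renaming (_∈?_ to _∈ₛ?_)
open import Data.List using (List; []; _∷_; _++_; filter; length)
open import Data.List.Membership.Propositional using (_∈_)
open import Data.List.Relation.Unary.All using (All)
open import Data.List.Relation.Unary.Unique.Propositional using (Unique)
open import Data.Maybe using (Maybe; just; nothing)
open import Data.Product using (Σ; _×_; ∃; _,_)
open import Data.Sum using (_⊎_)
open import Relation.Binary.PropositionalEquality using (_≡_; _≢_)
open import Relation.Nullary using (¬_)
open import Relation.Nullary.Decidable using (_⊎-dec_)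
open import Function.Bundles using (_⇔_)

module _ {n : ℕ} where

  -- A linear order is a word (list) from top to bottom.
  Order : Set
  Order = List (Fin n)

  IsLinOrd : Subset n → Order → Set
  IsLinOrd S R = Unique R × (∀ a → (a ∈ R) ⇔ (a ∈ₛ S))

  Domain : Set₁
  Domain = Order → Set

  restrict : Subset n → Order → Order
  restrict B R = filter (_∈ₛ? B) R

  restrictDom : Subset n → Domain → Domain
  restrictDom B D S = Σ Order λ R → D R × restrict B R ≡ S

  InTriple : Fin n → Fin n → Fin n → Fin n → Set
  InTriple a b c y = y ≡ a ⊎ y ≡ b ⊎ y ≡ c

  restrict3 : Fin n → Fin n → Fin n → Order → Order
  restrict3 a b c R = filter (λ y → (y ≟ a) ⊎-dec ((y ≟ b) ⊎-dec (y ≟ c))) R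

nth : {A : Set} → List A → ℕ → Maybe A
nth []       _       = nothing
nth (x ∷ xs) zero    = just x
nth (x ∷ xs) (suc k) = nth xs k

module _ {n : ℕ} where

  -- never-condition x N_{a,b,c} k, with k given 0-based (k = 0 top, k = 2 bottom)
  Never : Domain {n} → Fin n → Fin n → Fin n → Fin n → ℕ → Set
  Never D a b c x k = ∀ R → D R → nth (restrict3 a b c R) k ≢ just x

  Distinct3 : Fin n → Fin n → Fin n → Set
  Distinct3 a b c = a ≢ b × a ≢ c × b ≢ c

  PeakPit : Subset n → Domain {n} → Set
  PeakPit B D =
    (∀ R → D R → IsLinOrd B R) ×
    (∀ a b c → a ∈ₛ B → b ∈ₛ B → c ∈ₛ B → Distinct3 a b c →
      ∃ λ x → InTriple a b c x × (Never D a b c x 0 ⊎ Never D a b c x 2))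

  Alike : Order {n} → Order {n} → Set
  Alike R T = ∃ λ xs → ∃ λ ys → ∃ λ a → ∃ λ b →
    R ≡ xs ++ a ∷ b ∷ ys × T ≡ xs ++ b ∷ a ∷ ys

  data Walk : Order {n} → Order {n} → List (Order {n}) → Set where
    here : ∀ {R} → Walk R R (R ∷ [])
    step : ∀ {R S T P} → Alike R S → Walk S T P → Walk R T (R ∷ P)

  PathIn : Subset n → Order {n} → Order {n} → List (Order {n}) → Set
  PathIn B R T P = Walk R T P × All (IsLinOrd B) P

  Geodesic : Subset n → Order {n} → Order {n} → List (Order {n}) → Set
  Geodesic B R T P = PathIn B R T P × (∀ Q → PathIn B R T Q → length P ≤ length Q)

  _∪L_ : Domain {n} → List (Order {n}) → Domain {n}
  (D ∪L P) S = D S ⊎ S ∈ P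

{-# OPTIONS --safe #-}
module Submission where

-- Fix, for every triple of B, a never-condition satisfied by D, and let L be the finite family of
-- Boolean relations made of R_B, T_B and all linear orders on B obeying these conditions: L is peak-pit
-- and covers D_B. Walk from S = R_B to T_B, each time reversing a pair that is adjacent in S and ranked
-- the other way by T, and add each new order to L keeping L peak-pit. If for some Q in L the median of
-- S, T and Q lies strictly between S and T, it may join L (medians of members of a peak-pit family are
-- linear orders satisfying its never-conditions), it is closer to S, and an adjacent pair it reverses
-- is reversed by T as well, so aim at it instead. Otherwise every such median is S or T, and then a
-- reversal putting y on top of a triple in which y was never on top leaves y never at the bottom of
-- it. Every step lowers the number of pairs on which S and T disagree by exactly one, and no step can
-- lower it by more, so the walk is a geodesic.

open import Defs
open import Data.Bool using (Bool; true; false; not; _∧_; _∨_; if_then_else_)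
import Data.Bool.Properties as Bool
open import Data.Empty using (⊥; ⊥-elim)
open import Data.Fin using (Fin; zero; suc; combine; remQuot)
open import Data.Fin.Properties using (_≟_; all?; any?; remQuot-combine; combine-remQuot; suc-injective)
open import Data.Fin.Subset using (Subset; ∣_∣; ⊤) renaming (_∈_ to _∈ₛ_)
open import Data.Fin.Subset.Properties using (∈⊤) renaming (_∈?_ to _∈ₛ?_)
open import Data.List using (List; []; _∷_; _++_; filter; map; length; cartesianProductWith)
open import Data.List.Membership.Propositional using (_∈_; find; lose)
open import Data.List.Membership.Propositional.Properties
  using (∈-filter⁻; ∈-filter⁺; ∈-map⁺; ∈-cartesianProductWith⁺)
open import Data.List.Relation.Binary.Permutation.Propositional using (_↭_; swap; ↭-refl; ↭-sym; ↭⇒↭ₛ′)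
open import Data.List.Relation.Binary.Permutation.Propositional.Properties using (∈-resp-↭; ++⁺ˡ)
import Data.List.Relation.Binary.Permutation.Setoid.Properties as SetoidPermutation
open import Data.List.Relation.Binary.Subset.Propositional.Properties using (xs⊆x∷xs; ∷⁺ʳ)
open import Data.List.Relation.Unary.All using (All; []; _∷_)
import Data.List.Relation.Unary.All as All
open import Data.List.Relation.Unary.Any using (here; there)
import Data.List.Relation.Unary.Any as Any
open import Data.List.Relation.Unary.Unique.Propositional using (Unique; []; _∷_)
open import Data.List.Relation.Unary.Unique.Propositional.Properties using (filter⁺)
open import Data.Maybe using (just)
open import Data.Nat using (ℕ; zero; suc; _≤_; _<_; z≤n; s≤s)
open import Data.Nat.Induction using (<-wellFounded)
open import Data.Nat.Properties using (≤-refl; ≤-trans; ≤-reflexive; m≤n⇒m≤1+n; n≤1+n; module ≤-Reasoning)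
open import Data.Product using (_×_; _,_; ∃; ∃₂; Σ; proj₁; proj₂; uncurry)
import Data.Product as Product
open import Data.Sum using (_⊎_; inj₁; inj₂; [_,_]′)
import Data.Sum as Sum
import Data.Vec.Functional as Vector
open import Function using (_∘_; id; flip; const)
open import Function.Bundles using (Equivalence; mk⇔)
open import Induction.WellFounded using (Acc; acc)
open import Level using (0ℓ)
open import Relation.Binary.Definitions using () renaming (Decidable to Decidable₂)
open import Relation.Binary.PropositionalEquality as ≡
  using (_≡_; _≢_; refl; sym; cong; cong₂; cong-app; subst; _≗_; setoid; isEquivalence)
open import Relation.Nullary using (¬_; Dec; yes; no; does; ¬?)
open import Relation.Nullary.Decidable using (map′; _×-dec_; _⊎-dec_; _→-dec_; dec-true; dec-false)
open import Relation.Unary using (Pred; Decidable; _⊆_; _∪_)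

open Equivalence using (to; from)

Rel : ℕ → Set
Rel n = Fin n → Fin n → Bool

Family : ℕ → Set₁
Family n = Rel n → Set

data Pole : Set where
  top bottom : Pole

private
  variable
    m n : ℕ
    A : Set
    α β γ : Bool
    a b c p q r s t u v w x y z : Fin n
    B : Subset n
    ws xs ys F S S′ : List (Fin n)
    P : List (List (Fin n))
    D : Domain {n}
    E E′ : Family n
    L : List (Rel n)
    Q R R′ T X Y X₁ X₂ X₃ : Rel n
    π : Pole

-- Lists as linear orders

data Above {n : ℕ} : List (Fin n) → Fin n → Fin n → Set where
  here  : v ∈ ws → Above (u ∷ ws) u v
  there : Above ws u v → Above (w ∷ ws) u v

Above-∈ˡ : Above ws u v → u ∈ ws
Above-∈ˡ (here _)  = here refl
Above-∈ˡ (there p) = there (Above-∈ˡ p)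

Above-∈ʳ : Above ws u v → v ∈ ws
Above-∈ʳ (here v∈) = there v∈
Above-∈ʳ (there p) = there (Above-∈ʳ p)

Above-¬head : Unique (w ∷ ws) → ¬ Above (w ∷ ws) u w
Above-¬head (w∉ ∷ _) (here w∈) = All.lookup w∉ w∈ refl
Above-¬head (w∉ ∷ _) (there p) = All.lookup w∉ (Above-∈ʳ p) refl

Above-asym : Unique ws → Above ws u v → ¬ Above ws v u
Above-asym uq       (here _)    q         = Above-¬head uq q
Above-asym uq       p@(there _) (here _)  = Above-¬head uq p
Above-asym (_ ∷ uq) (there p)   (there q) = Above-asym uq p q

Above-total : u ∈ ws → v ∈ ws → u ≢ v → Above ws u v ⊎ Above ws v u
Above-total (here refl) (here refl) u≢v = ⊥-elim (u≢v refl)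
Above-total (here refl) (there v∈)  _   = inj₁ (here v∈)
Above-total (there u∈)  (here refl) _   = inj₂ (here u∈)
Above-total (there u∈)  (there v∈)  u≢v = Sum.map there there (Above-total u∈ v∈ u≢v)

Above-trans : Unique ws → Above ws u v → Above ws v w → Above ws u w
Above-trans _        (here _)    (here w∈) = here w∈
Above-trans _        (here _)    (there q) = here (Above-∈ʳ q)
Above-trans uq       p@(there _) (here _)  = ⊥-elim (Above-¬head uq p)
Above-trans (_ ∷ uq) (there p)   (there q) = there (Above-trans uq p q)

Above-adjacent : ∀ xs → Above (xs ++ a ∷ b ∷ ys) a b
Above-adjacent []       = here (here refl)
Above-adjacent (_ ∷ xs) = there (Above-adjacent xs)

swap-↭ : ∀ xs → xs ++ a ∷ b ∷ ys ↭ xs ++ b ∷ a ∷ ys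
swap-↭ {a = a} {b} xs = ++⁺ˡ xs (swap a b ↭-refl)

Unique-swap : ∀ xs → Unique (xs ++ a ∷ b ∷ ys) → Unique (xs ++ b ∷ a ∷ ys)
Unique-swap xs = SetoidPermutation.Unique-resp-↭ (setoid _) (↭⇒↭ₛ′ isEquivalence (swap-↭ xs))

Above-swap : ∀ xs → Above (xs ++ a ∷ b ∷ ys) u v → (u ≡ a × v ≡ b) ⊎ Above (xs ++ b ∷ a ∷ ys) u v
Above-swap []       (here (here refl)) = inj₁ (refl , refl)
Above-swap []       (here (there v∈))  = inj₂ (there (here v∈))
Above-swap []       (there (here v∈))  = inj₂ (here (there v∈))
Above-swap []       (there (there p))  = inj₂ (there (there p))
Above-swap (_ ∷ xs) (here v∈)          = inj₂ (here (∈-resp-↭ (swap-↭ xs) v∈))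
Above-swap (_ ∷ xs) (there p)          = Sum.map₂ there (Above-swap xs p)

module _ {P : Pred (Fin n) 0ℓ} (P? : Decidable P) where

  Above-filter⁻ : Above (filter P? ws) u v → Above ws u v
  Above-filter⁻ {ws = w ∷ ws} p with does (P? w) | p
  ... | true  | here v∈ = here (proj₁ (∈-filter⁻ P? v∈))
  ... | true  | there q = there (Above-filter⁻ q)
  ... | false | q       = there (Above-filter⁻ q)

  Above-filter⁺ : P u → P v → Above ws u v → Above (filter P? ws) u v
  Above-filter⁺ {u = u} Pu Pv (here v∈) with P? u
  ... | yes _  = here (∈-filter⁺ P? v∈ Pv)
  ... | no ¬Pu = ⊥-elim (¬Pu Pu)
  Above-filter⁺ Pu Pv (there {w = w} p) with does (P? w)
  ... | true  = there (Above-filter⁺ Pu Pv p)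
  ... | false = Above-filter⁺ Pu Pv p

above? : ∀ ws (u v : Fin n) → Dec (Above ws u v)
above? []       u v = no λ ()
above? (w ∷ ws) u v = map′ join split ((w ≟ u ×-dec Any.any? (v ≟_) ws) ⊎-dec above? ws u v)
  where
    join : (w ≡ u × v ∈ ws) ⊎ Above ws u v → Above (w ∷ ws) u v
    join (inj₁ (refl , v∈)) = here v∈
    join (inj₂ p)           = there p
    split : Above (w ∷ ws) u v → (w ≡ u × v ∈ ws) ⊎ Above ws u v
    split (here v∈) = inj₁ (refl , v∈)
    split (there p) = inj₂ p

above : List (Fin n) → Rel n
above ws u v = does (above? ws u v)

above⁺ : Above ws u v → above ws u v ≡ true
above⁺ {ws = ws} {u} {v} = dec-true (above? ws u v)

above⁻ : above ws u v ≡ true → Above ws u v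
above⁻ {ws = ws} {u} {v} e with above? ws u v
above⁻ e  | yes p = p
above⁻ () | no _

IsLinOrd-swap : ∀ xs → IsLinOrd B (xs ++ a ∷ b ∷ ys) → IsLinOrd B (xs ++ b ∷ a ∷ ys)
IsLinOrd-swap xs (uq , mem) = Unique-swap xs uq , λ w →
  mk⇔ (to (mem w) ∘ ∈-resp-↭ (↭-sym (swap-↭ xs))) (∈-resp-↭ (swap-↭ xs) ∘ from (mem w))

∈-tail : w ∈ x ∷ xs → w ≢ x → w ∈ xs
∈-tail (here w≡x) w≢x = ⊥-elim (w≢x w≡x)
∈-tail (there w∈) _   = w∈

same-order : Unique S → Unique S′ → (∀ {w} → w ∈ S → w ∈ S′) → (∀ {w} → w ∈ S′ → w ∈ S) →
             (∀ {u v} → Above S u v → ¬ Above S′ v u) → S ≡ S′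
same-order [] [] _ _ _ = refl
same-order [] (_ ∷ _) _ S′⊆S _ with S′⊆S (here refl)
... | ()
same-order (_ ∷ _) [] S⊆S′ _ _ with S⊆S′ (here refl)
... | ()
same-order {S = s ∷ S} {S′ = t ∷ S′} (s∉ ∷ uq) (t∉ ∷ uq′) S⊆S′ S′⊆S agree with s ≟ t
... | yes refl = cong (s ∷_) (same-order uq uq′
        (λ w∈ → ∈-tail (S⊆S′ (there w∈)) (All.lookup s∉ w∈ ∘ sym))
        (λ w∈ → ∈-tail (S′⊆S (there w∈)) (All.lookup t∉ w∈ ∘ sym))
        (λ p q → agree (there p) (there q)))
... | no s≢t = ⊥-elim (agree (here (∈-tail (S′⊆S (here refl)) (s≢t ∘ sym))) (here (∈-tail (S⊆S′ (here refl)) s≢t)))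

-- Linear orders as Boolean relations

true≢false : α ≡ true → α ≢ false
true≢false refl ()

_≗₂_ : Rel n → Rel n → Set
X ≗₂ Y = ∀ u v → X u v ≡ Y u v

_⊑_ : Rel n → Rel n → Set
X ⊑ Y = ∀ {u v} → X u v ≡ true → Y u v ≡ true

record IsLinearOn (B : Subset n) (X : Rel n) : Set where
  field
    support : X u v ≡ true → u ∈ₛ B × v ∈ₛ B
    asym    : X u v ≡ true → X v u ≡ false
    total   : u ∈ₛ B → v ∈ₛ B → u ≢ v → X u v ≡ true ⊎ X v u ≡ true
    trans   : X u v ≡ true → X v w ≡ true → X u w ≡ true

  irrefl : X u v ≡ true → u ≢ v
  irrefl Xuv refl = true≢false Xuv (asym Xuv)

  complete : u ∈ₛ B → v ∈ₛ B → u ≢ v → X u v ≡ false → X v u ≡ true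
  complete u∈ v∈ u≢v Xuv with total u∈ v∈ u≢v
  ... | inj₁ Xuv′ = ⊥-elim (true≢false Xuv′ Xuv)
  ... | inj₂ Xvu  = Xvu

  converse : u ∈ₛ B → v ∈ₛ B → u ≢ v → X v u ≡ not (X u v)
  converse {u} {v} u∈ v∈ u≢v with X u v in Xuv
  ... | true  = asym Xuv
  ... | false = complete u∈ v∈ u≢v Xuv

open IsLinearOn

above-linear : IsLinOrd B ws → IsLinearOn B (above ws)
above-linear (uq , mem) = record
  { support = λ e → let p = above⁻ e in to (mem _) (Above-∈ˡ p) , to (mem _) (Above-∈ʳ p)
  ; asym    = λ e → dec-false (above? _ _ _) (Above-asym uq (above⁻ e))
  ; total   = λ u∈ v∈ u≢v → Sum.map above⁺ above⁺ (Above-total (from (mem _) u∈) (from (mem _) v∈) u≢v)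
  ; trans   = λ e₁ e₂ → above⁺ (Above-trans uq (above⁻ e₁) (above⁻ e₂))
  }

flip-linear : IsLinearOn B X → IsLinearOn B (flip X)
flip-linear L = record
  { support = Product.swap ∘ support L
  ; asym    = asym L
  ; total   = λ u∈ v∈ u≢v → total L v∈ u∈ (u≢v ∘ sym)
  ; trans   = λ e₁ e₂ → trans L e₂ e₁
  }

∷-linear : IsLinearOn B X → (_∈ L) ⊆ IsLinearOn B → (_∈ X ∷ L) ⊆ IsLinearOn B
∷-linear X-lin _      (here refl) = X-lin
∷-linear _     linear (there X∈)  = linear X∈

IsLinearOn-≗₂ : X ≗₂ Y → IsLinearOn B X → IsLinearOn B Y
IsLinearOn-≗₂ {X = X} {Y = Y} X≗Y L = record
  { support = support L ∘ ⇐
  ; asym    = λ e → ≡.trans (sym (X≗Y _ _)) (asym L (⇐ e))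
  ; total   = λ u∈ v∈ u≢v → Sum.map ⇒ ⇒ (total L u∈ v∈ u≢v)
  ; trans   = λ e₁ e₂ → ⇒ (trans L (⇐ e₁) (⇐ e₂))
  }
  where
    ⇐ : Y ⊑ X
    ⇐ = ≡.trans (X≗Y _ _)
    ⇒ : X ⊑ Y
    ⇒ = ≡.trans (sym (X≗Y _ _))

-- Peak-pit families of relations and their medians

AtPole : Pole → Rel n → Fin n → Fin n → Fin n → Set
AtPole top    X x y z = X x y ≡ true × X x z ≡ true
AtPole bottom X x y z = X y x ≡ true × X z x ≡ true

atPole? : ∀ π (X : Rel n) x y z → Dec (AtPole π X x y z)
atPole? top    X x y z = (X x y Bool.≟ true) ×-dec (X x z Bool.≟ true)
atPole? bottom X x y z = (X y x Bool.≟ true) ×-dec (X z x Bool.≟ true)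

AtPole-⊑ : X ⊑ Y → AtPole π X x y z → AtPole π Y x y z
AtPole-⊑ {π = top}    X⊑Y (p , q) = X⊑Y p , X⊑Y q
AtPole-⊑ {π = bottom} X⊑Y (p , q) = X⊑Y p , X⊑Y q

NeverAt : Pole → Family n → Fin n → Fin n → Fin n → Set
NeverAt π E x y z = ∀ {X} → E X → ¬ AtPole π X x y z

NeverAt-∷ : ¬ AtPole π X x y z → NeverAt π (_∈ L) x y z → NeverAt π (_∈ X ∷ L) x y z
NeverAt-∷ ¬at _     (here refl) = ¬at
NeverAt-∷ _   never (there X∈)  = never X∈

opposite : Pole → Pole
opposite top    = bottom
opposite bottom = top

data IsRotation (a b c : Fin n) : Fin n → Fin n → Fin n → Set where
  rot₀ : IsRotation a b c a b c
  rot₁ : IsRotation a b c b c a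
  rot₂ : IsRotation a b c c a b

Triple : Subset n → Fin n → Fin n → Fin n → Set
Triple B x y z = x ∈ₛ B × y ∈ₛ B × z ∈ₛ B × Distinct3 x y z

Triple-swap : Triple B x y z → Triple B x z y
Triple-swap (x∈ , y∈ , z∈ , x≢y , x≢z , y≢z) = x∈ , z∈ , y∈ , x≢z , x≢y , y≢z ∘ sym

Triple-rotate : IsRotation a b c x y z → Triple B a b c → Triple B x y z
Triple-rotate rot₀ t = t
Triple-rotate rot₁ (a∈ , b∈ , c∈ , a≢b , a≢c , b≢c) = b∈ , c∈ , a∈ , b≢c , a≢b ∘ sym , a≢c ∘ sym
Triple-rotate rot₂ (a∈ , b∈ , c∈ , a≢b , a≢c , b≢c) = c∈ , a∈ , b∈ , a≢c ∘ sym , b≢c ∘ sym , a≢b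

-- "x is never at the π-end of {a, b, c}", where (x, y, z) is the rotation of (a, b, c) starting at x
data NeverCondition (a b c : Fin n) : Set where
  never-at : IsRotation a b c x y z → Pole → NeverCondition a b c

Violates : {a b c : Fin n} → Rel n → NeverCondition a b c → Set
Violates X (never-at {x = x} {y} {z} _ π) = AtPole π X x y z

violates? : {a b c : Fin n} (X : Rel n) (κ : NeverCondition a b c) → Dec (Violates X κ)
violates? X (never-at _ π) = atPole? π X _ _ _

Violates-⊑ : {κ : NeverCondition a b c} → X ⊑ Y → Violates X κ → Violates Y κ
Violates-⊑ {κ = never-at _ _} = AtPole-⊑

IsPeakPit : Subset n → Family n → Set
IsPeakPit B E = ∀ {a b c} → Triple B a b c → ∃ λ (κ : NeverCondition a b c) → ∀ {X} → E X → ¬ Violates X κ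

refine : (∀ {π x y z} → Triple B x y z → NeverAt π E x y z → ∃ λ π′ → NeverAt π′ E′ x y z) →
         IsPeakPit B E → IsPeakPit B E′
refine preserve peakPit t with peakPit t
... | never-at ρ π , never with preserve (Triple-rotate ρ t) never
...   | π′ , never′ = never-at ρ π′ , never′

IsPeakPit-⊆ : E′ ⊆ E → IsPeakPit B E → IsPeakPit B E′
IsPeakPit-⊆ E′⊆E = refine λ {π} _ never → π , never ∘ E′⊆E

Ranks : Rel n → Fin n → Fin n → Fin n → Set
Ranks X x y z = X x y ≡ true × X y z ≡ true × X x z ≡ true

ranks : IsLinearOn B X → X x y ≡ true → X y z ≡ true → Ranks X x y z
ranks L Xxy Xyz = Xxy , Xyz , trans L Xxy Xyz

-- each of u, v, w is on top in one of the three orders and at the bottom in another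
no-latin-square : IsPeakPit B E → Triple B u v w → E X₁ → E X₂ → E X₃ →
                  Ranks X₁ w u v → Ranks X₂ u v w → Ranks X₃ v w u → ⊥
no-latin-square peakPit t X₁∈ X₂∈ X₃∈ (wu , uv , wv) (uv′ , vw , uw) (vw′ , wu′ , vu) with peakPit t
... | never-at rot₀ top    , never = never X₂∈ (uv′ , uw)
... | never-at rot₀ bottom , never = never X₃∈ (vu , wu′)
... | never-at rot₁ top    , never = never X₃∈ (vw′ , vu)
... | never-at rot₁ bottom , never = never X₁∈ (wv , uv)
... | never-at rot₂ top    , never = never X₁∈ (wu , wv)
... | never-at rot₂ bottom , never = never X₂∈ (uw , vw)

maj : Bool → Bool → Bool → Bool
maj true  β γ = β ∨ γ
maj false β γ = β ∧ γ

maj-not : ∀ α β γ → maj (not α) (not β) (not γ) ≡ not (maj α β γ)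
maj-not true  true  _     = refl
maj-not true  false true  = refl
maj-not true  false false = refl
maj-not false true  true  = refl
maj-not false true  false = refl
maj-not false false _     = refl

maj-₁₂ : α ≡ true → β ≡ true → maj α β γ ≡ true
maj-₁₂ refl refl = refl

maj-₁₃ : α ≡ true → γ ≡ true → maj α β γ ≡ true
maj-₁₃ {β = true}  refl refl = refl
maj-₁₃ {β = false} refl refl = refl

maj-₂₃ : β ≡ true → γ ≡ true → maj α β γ ≡ true
maj-₂₃ {α = true}  refl refl = refl
maj-₂₃ {α = false} refl refl = refl

maj-shared : ∀ α β γ α′ β′ γ′ → maj α β γ ≡ true → maj α′ β′ γ′ ≡ true →
             (α ≡ true × α′ ≡ true) ⊎ (β ≡ true × β′ ≡ true) ⊎ (γ ≡ true × γ′ ≡ true)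
maj-shared true  _     _     true  _     _     _  _  = inj₁ (refl , refl)
maj-shared true  true  _     false true  true  _  _  = inj₂ (inj₁ (refl , refl))
maj-shared true  false true  false true  true  _  _  = inj₂ (inj₂ (refl , refl))
maj-shared false true  true  true  true  _     _  _  = inj₂ (inj₁ (refl , refl))
maj-shared false true  true  true  false true  _  _  = inj₂ (inj₂ (refl , refl))
maj-shared false true  true  false true  true  _  _  = inj₂ (inj₁ (refl , refl))
maj-shared true  false false _     _     _     () _
maj-shared false false _     _     _     _     () _
maj-shared false true  false _     _     _     () _
maj-shared _     _     _     false false _     _  ()
maj-shared _     _     _     false true  false _  ()
maj-shared false true  true  true  false false _  ()

med : Rel n → Rel n → Rel n → Rel n
med R T Q u v = maj (R u v) (T u v) (Q u v)

med-shared : E R → E T → E Q → med R T Q u v ≡ true → med R T Q s t ≡ true →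
             ∃ λ X → E X × X u v ≡ true × X s t ≡ true
med-shared {R = R} {T = T} {Q = Q} {u = u} {v} {s} {t} R∈ T∈ Q∈ m₁ m₂
  with maj-shared (R u v) (T u v) (Q u v) (R s t) (T s t) (Q s t) m₁ m₂
... | inj₁ (p , q)        = R , R∈ , p , q
... | inj₂ (inj₁ (p , q)) = T , T∈ , p , q
... | inj₂ (inj₂ (p , q)) = Q , Q∈ , p , q

med-never : E R → E T → E Q → NeverAt π E x y z → ¬ AtPole π (med R T Q) x y z
med-never {E = E} {π = top} R∈ T∈ Q∈ never (p , q) with med-shared {E = E} R∈ T∈ Q∈ p q
... | _ , X∈ , p′ , q′ = never X∈ (p′ , q′)
med-never {E = E} {π = bottom} R∈ T∈ Q∈ never (p , q) with med-shared {E = E} R∈ T∈ Q∈ p q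
... | _ , X∈ , p′ , q′ = never X∈ (p′ , q′)

med-peakPit : IsPeakPit B (_∈ L) → R ∈ L → T ∈ L → Q ∈ L → IsPeakPit B (_∈ med R T Q ∷ L)
med-peakPit peakPit R∈ T∈ Q∈ =
  refine (λ {π} _ never → π , NeverAt-∷ (med-never R∈ T∈ Q∈ never) never) peakPit

med-toward : IsLinearOn B R → R x y ≡ true → med R T Q y x ≡ true → T y x ≡ true
med-toward {R = R} {x = x} {y} {T = T} {Q} R-lin Rxy m =
  Bool.∧-conicalˡ _ _ (subst (λ α → maj α (T y x) (Q y x) ≡ true) (asym R-lin Rxy) m)

module _ (peakPit : IsPeakPit B E) (linear : E ⊆ IsLinearOn B) (R∈ : E R) (T∈ : E T) (Q∈ : E Q) where

  private
    M = med R T Q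

    voter : M u v ≡ true → ∃ λ X → IsLinearOn B X × X u v ≡ true
    voter m with med-shared {E = E} R∈ T∈ Q∈ m m
    ... | X , X∈ , p , _ = X , linear X∈ , p

    M-support : M u v ≡ true → u ∈ₛ B × v ∈ₛ B
    M-support m with voter m
    ... | _ , L , p = support L p

    M-irrefl : M u v ≡ true → u ≢ v
    M-irrefl m with voter m
    ... | _ , L , p = irrefl L p

    M-converse : u ∈ₛ B → v ∈ₛ B → u ≢ v → M v u ≡ not (M u v)
    M-converse {u} {v} u∈ v∈ u≢v
      rewrite converse (linear R∈) u∈ v∈ u≢v | converse (linear T∈) u∈ v∈ u≢v | converse (linear Q∈) u∈ v∈ u≢v
      = maj-not (R u v) (T u v) (Q u v)

    M-complete : u ∈ₛ B → v ∈ₛ B → u ≢ v → M u v ≡ false → M v u ≡ true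
    M-complete u∈ v∈ u≢v m rewrite M-converse u∈ v∈ u≢v | m = refl

    M-asym : M u v ≡ true → M v u ≡ false
    M-asym m with M-support m
    ... | u∈ , v∈ rewrite M-converse u∈ v∈ (M-irrefl m) | m = refl

    M-total : u ∈ₛ B → v ∈ₛ B → u ≢ v → M u v ≡ true ⊎ M v u ≡ true
    M-total {u} {v} u∈ v∈ u≢v with M u v in m
    ... | true  = inj₁ refl
    ... | false = inj₂ (M-complete u∈ v∈ u≢v m)

    voterRanks : M x y ≡ true → M y z ≡ true → ∃ λ X → E X × Ranks X x y z
    voterRanks m₁ m₂ with med-shared {E = E} R∈ T∈ Q∈ m₁ m₂
    ... | X , X∈ , p , q = X , X∈ , ranks (linear X∈) p q

    -- a cycle u > v > w > u of the median would produce a Latin square of voters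
    M-trans : M u v ≡ true → M v w ≡ true → M u w ≡ true
    M-trans {u} {v} {w} uv vw with M-support uv | M-support vw | u ≟ w | M u w in uw
    ... | _       | _      | _        | true  = refl
    ... | _       | _      | yes refl | false = ⊥-elim (true≢false vw (M-asym uv))
    ... | u∈ , v∈ | _ , w∈ | no u≢w   | false
      with voterRanks (M-complete u∈ w∈ u≢w uw) uv | voterRanks uv vw | voterRanks vw (M-complete u∈ w∈ u≢w uw)
    ... | _ , X₁∈ , r₁ | _ , X₂∈ , r₂ | _ , X₃∈ , r₃ =
      ⊥-elim (no-latin-square peakPit (u∈ , v∈ , w∈ , M-irrefl uv , u≢w , M-irrefl vw) X₁∈ X₂∈ X₃∈ r₁ r₂ r₃)

  med-linear : IsLinearOn B M
  med-linear = record { support = M-support ; asym = M-asym ; total = M-total ; trans = M-trans }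

-- Distance

count : {P : Pred (Fin m) 0ℓ} → Decidable P → ℕ
count {zero}  P? = 0
count {suc m} P? = if does (P? zero) then suc (count (P? ∘ suc)) else count (P? ∘ suc)

count-mono : {P Q : Pred (Fin m) 0ℓ} (P? : Decidable P) (Q? : Decidable Q) → P ⊆ Q → count P? ≤ count Q?
count-mono {zero}  P? Q? P⊆Q = z≤n
count-mono {suc m} P? Q? P⊆Q with P? zero | Q? zero
... | yes _ | yes _ = s≤s (count-mono (P? ∘ suc) (Q? ∘ suc) P⊆Q)
... | yes p | no ¬q = ⊥-elim (¬q (P⊆Q p))
... | no _  | yes _ = m≤n⇒m≤1+n (count-mono (P? ∘ suc) (Q? ∘ suc) P⊆Q)
... | no _  | no _  = count-mono (P? ∘ suc) (Q? ∘ suc) P⊆Q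

count-strict : {P Q : Pred (Fin m) 0ℓ} (P? : Decidable P) (Q? : Decidable Q) → P ⊆ Q →
               ∀ i → ¬ P i → Q i → count P? < count Q?
count-strict P? Q? P⊆Q zero ¬p q with P? zero | Q? zero
... | yes p | _     = ⊥-elim (¬p p)
... | no _  | no ¬q = ⊥-elim (¬q q)
... | no _  | yes _ = s≤s (count-mono (P? ∘ suc) (Q? ∘ suc) P⊆Q)
count-strict P? Q? P⊆Q (suc i) ¬p q with P? zero | Q? zero
... | yes _ | yes _ = s≤s (count-strict (P? ∘ suc) (Q? ∘ suc) P⊆Q i ¬p q)
... | yes p | no ¬q = ⊥-elim (¬q (P⊆Q p))
... | no _  | yes _ = m≤n⇒m≤1+n (count-strict (P? ∘ suc) (Q? ∘ suc) P⊆Q i ¬p q)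
... | no _  | no _  = count-strict (P? ∘ suc) (Q? ∘ suc) P⊆Q i ¬p q

count-≤-suc-tail : {P : Pred (Fin (suc m)) 0ℓ} (P? : Decidable P) → count P? ≤ suc (count (P? ∘ suc))
count-≤-suc-tail P? with P? zero
... | yes _ = ≤-refl
... | no _  = n≤1+n _

count-tail-≤ : {P : Pred (Fin (suc m)) 0ℓ} (P? : Decidable P) → count (P? ∘ suc) ≤ count P?
count-tail-≤ P? with P? zero
... | yes _ = n≤1+n _
... | no _  = ≤-refl

count-≤-suc : {P Q : Pred (Fin m) 0ℓ} (P? : Decidable P) (Q? : Decidable Q) →
              ∀ i → (∀ {j} → P j → j ≡ i ⊎ Q j) → count P? ≤ suc (count Q?)
count-≤-suc P? Q? zero P⊆iQ = begin
  count P?               ≤⟨ count-≤-suc-tail P? ⟩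
  suc (count (P? ∘ suc)) ≤⟨ s≤s (count-mono (P? ∘ suc) (Q? ∘ suc) λ {j} p → [ (λ ()) , id ]′ (P⊆iQ {suc j} p)) ⟩
  suc (count (Q? ∘ suc)) ≤⟨ s≤s (count-tail-≤ Q?) ⟩
  suc (count Q?)         ∎
  where open ≤-Reasoning
count-≤-suc P? Q? (suc i) P⊆iQ with P? zero | Q? zero | count-≤-suc (P? ∘ suc) (Q? ∘ suc) i tail
  where tail = λ {j} p → Sum.map₁ suc-injective (P⊆iQ {suc j} p)
... | yes _ | yes _ | ih = s≤s ih
... | yes p | no ¬q | _  = ⊥-elim (¬q ([ (λ ()) , id ]′ (P⊆iQ {zero} p)))
... | no _  | yes _ | ih = m≤n⇒m≤1+n ih
... | no _  | no _  | ih = ih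

count-none : {P : Pred (Fin m) 0ℓ} (P? : Decidable P) → (∀ i → ¬ P i) → count P? ≡ 0
count-none {zero}  P? ¬P = refl
count-none {suc m} P? ¬P with P? zero
... | yes p = ⊥-elim (¬P zero p)
... | no _  = count-none (P? ∘ suc) (¬P ∘ suc)

-- a pair (u , v) is counted at position combine u v of Fin (n * n)
onPairs : {P : Fin n → Fin n → Set} → Decidable₂ P → Decidable (uncurry P ∘ remQuot n)
onPairs {n} P? k = uncurry P? (remQuot n k)

count₂ : {P : Fin n → Fin n → Set} → Decidable₂ P → ℕ
count₂ P? = count (onPairs P?)

module _ {P Q : Fin n → Fin n → Set} (P? : Decidable₂ P) (Q? : Decidable₂ Q) where

  count₂-strict : (∀ {u v} → P u v → Q u v) → ¬ P u v → Q u v → count₂ P? < count₂ Q?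
  count₂-strict {u} {v} P⊆Q ¬p q = count-strict (onPairs P?) (onPairs Q?) P⊆Q (combine u v)
    (¬p ∘ subst (uncurry P) (remQuot-combine u v))
    (subst (uncurry Q) (sym (remQuot-combine u v)) q)

  count₂-≤-suc : (∀ {s t} → P s t → (s ≡ u × t ≡ v) ⊎ Q s t) → count₂ P? ≤ suc (count₂ Q?)
  count₂-≤-suc {u} {v} P⊆uvQ = count-≤-suc (onPairs P?) (onPairs Q?) (combine u v) (Sum.map₁ (at _) ∘ P⊆uvQ)
    where
      at : ∀ k → proj₁ (remQuot {n} n k) ≡ u × proj₂ (remQuot {n} n k) ≡ v → k ≡ combine u v
      at k (e₁ , e₂) = ≡.trans (sym (combine-remQuot {n} n k)) (cong₂ combine e₁ e₂)

count₂-none : {P : Fin n → Fin n → Set} (P? : Decidable₂ P) → (∀ u v → ¬ P u v) → count₂ P? ≡ 0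
count₂-none P? ¬P = count-none (onPairs P?) (λ _ → ¬P _ _)

Inverted : Rel n → Rel n → Fin n → Fin n → Set
Inverted X Y u v = X u v ≡ true × Y v u ≡ true

inverted? : (X Y : Rel n) → Decidable₂ (Inverted X Y)
inverted? X Y u v = (X u v Bool.≟ true) ×-dec (Y v u Bool.≟ true)

Inversion : Rel n → Rel n → Set
Inversion X Y = ∃₂ (Inverted X Y)

inversion? : (X Y : Rel n) → Dec (Inversion X Y)
inversion? X Y = any? λ u → any? λ v → inverted? X Y u v

dist : Rel n → Rel n → ℕ
dist X Y = count₂ (inverted? X Y)

no-inversion-⊑ : IsLinearOn B X → IsLinearOn B Y → ¬ Inversion X Y → X ⊑ Y
no-inversion-⊑ {Y = Y} X-lin Y-lin none {u} {v} Xuv with support X-lin Xuv | Y u v in Yuv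
... | _       | true  = refl
... | u∈ , v∈ | false = ⊥-elim (none (u , v , Xuv , complete Y-lin u∈ v∈ (irrefl X-lin Xuv) Yuv))

no-inversion⇒≗₂ : IsLinearOn B X → IsLinearOn B Y → ¬ Inversion X Y → X ≗₂ Y
no-inversion⇒≗₂ X-lin Y-lin none u v = Bool.⇔→≡ {z = true}
  (mk⇔ (no-inversion-⊑ X-lin Y-lin none) (no-inversion-⊑ Y-lin X-lin λ (u , v , Yuv , Xvu) → none (v , u , Xvu , Yuv)))

med-closer : IsLinearOn B R → IsLinearOn B T → IsLinearOn B (med R T Q) →
             Inversion T (med R T Q) → dist R (med R T Q) < dist R T
med-closer {R = R} {T = T} {Q = Q} R-lin T-lin M-lin (a , b , Tab , Mba) =
  count₂-strict (inverted? R (med R T Q)) (inverted? R T) (λ (Ruv , Mvu) → Ruv , med-toward {T = T} {Q = Q} R-lin Ruv Mvu)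
    (λ (_ , Mab) → true≢false Mab (asym M-lin Mba)) (Rba , Tab)
  where
    Rba : R b a ≡ true
    Rba with R a b in Rab | support T-lin Tab
    ... | true  | _       = ⊥-elim (true≢false (maj-₁₂ {γ = Q a b} Rab Tab) (asym M-lin Mba))
    ... | false | a∈ , b∈ = complete R-lin a∈ b∈ (irrefl T-lin Tab) Rab

-- Reversing one adjacent pair

record Reversal (R R′ : Rel n) (x y : Fin n) : Set where
  field
    before : R x y ≡ true
    after  : R′ x y ≡ false
    only   : R′ u v ≡ true → R u v ≡ true ⊎ (u ≡ y × v ≡ x)

swap-reversal : ∀ xs → Unique (xs ++ x ∷ y ∷ ys) → Reversal (above (xs ++ x ∷ y ∷ ys)) (above (xs ++ y ∷ x ∷ ys)) x y
swap-reversal xs uq = record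
  { before = above⁺ (Above-adjacent xs)
  ; after  = dec-false (above? _ _ _) (Above-asym (Unique-swap xs uq) (Above-adjacent xs))
  ; only   = [ inj₂ , inj₁ ∘ above⁺ ]′ ∘ Above-swap xs ∘ above⁻
  }

reversal-closer : Reversal R R′ x y → IsLinearOn B Y → Y y x ≡ true → dist R′ Y < dist R Y
reversal-closer {R = R} {R′ = R′} {Y = Y} rev Y-lin Yyx =
  count₂-strict (inverted? R′ Y) (inverted? R Y) moved (λ (R′xy , _) → true≢false R′xy after) (before , Yyx)
  where
    open Reversal rev
    moved : ∀ {u v} → Inverted R′ Y u v → Inverted R Y u v
    moved (p , q) with only p
    ... | inj₁ p′            = p′ , q
    ... | inj₂ (refl , refl) = ⊥-elim (true≢false q (asym Y-lin Yyx))

EndpointMedians : Family n → Rel n → Rel n → Set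
EndpointMedians E R T = ∀ {Q} → E Q → med R T Q ≗₂ R ⊎ med R T Q ≗₂ T

record SwapSetting (B : Subset n) (E : Family n) (R R′ T : Rel n) (x y : Fin n) : Set where
  field
    R-linear  : IsLinearOn B R
    T-linear  : IsLinearOn B T
    R∈        : E R
    T∈        : E T
    T-yx      : T y x ≡ true
    reversal  : Reversal R R′ x y
    endpoints : EndpointMedians E R T

  open Reversal reversal public

transpose : SwapSetting B E R R′ T x y → SwapSetting B (E ∘ flip) (flip R) (flip R′) (flip T) y x
transpose s = record
  { R-linear  = flip-linear R-linear
  ; T-linear  = flip-linear T-linear
  ; R∈        = R∈
  ; T∈        = T∈
  ; T-yx      = T-yx
  ; reversal  = record { before = before ; after = after ; only = Sum.map₂ Product.swap ∘ only }
  ; endpoints = Sum.map (λ h u v → h v u) (λ h u v → h v u) ∘ endpoints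
  }
  where open SwapSetting s

module _ (s : SwapSetting B E R R′ T x y) where
  open SwapSetting s

  -- a member Q of E with y at the bottom of {y, x, r} would have a median with R and T
  -- that agrees with R on (x, y) but with T on (r, y)
  never-top⇒never-bottom : Triple B y x r → NeverAt top E y x r → R′ y r ≡ true →
                           NeverAt bottom E y x r × ¬ AtPole bottom R′ y x r
  never-top⇒never-bottom {r = r} (y∈ , _ , r∈ , _ , y≢r , x≢r) never R′yr =
    never-bottom , λ (R′xy , _) → true≢false R′xy after
    where
      Ryr : R y r ≡ true
      Ryr = [ id , (λ (_ , r≡x) → ⊥-elim (x≢r (sym r≡x))) ]′ (only R′yr)
      Try : T r y ≡ true
      Try = [ (λ Tyr → ⊥-elim (never T∈ (T-yx , Tyr))) , id ]′ (total T-linear y∈ r∈ y≢r)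
      never-bottom : NeverAt bottom E y x r
      never-bottom Q∈ (Qxy , Qry) with endpoints Q∈
      ... | inj₁ M≗R = true≢false (≡.trans (sym (M≗R r y)) (maj-₂₃ {α = R r y} Try Qry)) (asym R-linear Ryr)
      ... | inj₂ M≗T = true≢false (≡.trans (sym (M≗T x y)) (maj-₁₃ {β = T x y} before Qxy)) (asym T-linear T-yx)

  never-top-after-swap : Triple B p q r → NeverAt top E p q r →
                         ¬ AtPole top R′ p q r ⊎ (NeverAt bottom E p q r × ¬ AtPole bottom R′ p q r)
  never-top-after-swap {p = p} {q} {r} t never with atPole? top R′ p q r
  ... | no ¬at = inj₁ ¬at
  ... | yes (R′pq , R′pr) with only R′pq | only R′pr
  ...   | inj₁ Rpq           | inj₁ Rpr           = ⊥-elim (never R∈ (Rpq , Rpr))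
  ...   | inj₂ (refl , refl) | _                  = inj₂ (never-top⇒never-bottom t never R′pr)
  ...   | inj₁ _             | inj₂ (refl , refl)
    with never-top⇒never-bottom (Triple-swap t) (λ X∈ (Xpr , Xpq) → never X∈ (Xpq , Xpr)) R′pq
  ...     | never′ , ¬at = inj₂ ((λ X∈ (Xrp , Xqp) → never′ X∈ (Xqp , Xrp)) , λ (R′rp , R′qp) → ¬at (R′qp , R′rp))

-- the case of a never-bottom condition is the case of a never-top condition for the transposed relations
never-after-swap : SwapSetting B E R R′ T x y → Triple B p q r → NeverAt π E p q r →
                   ¬ AtPole π R′ p q r ⊎ (NeverAt (opposite π) E p q r × ¬ AtPole (opposite π) R′ p q r)
never-after-swap {π = top}    s t never = never-top-after-swap s t never
never-after-swap {π = bottom} s t never =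
  Sum.map₂ (Product.map₁ λ never′ X∈ → never′ X∈) (never-top-after-swap (transpose s) t never)

swap-peakPit : ∀ {n} {B : Subset n} {L R R′ T x y} →
               IsPeakPit B (_∈ L) → SwapSetting B (_∈ L) R R′ T x y → IsPeakPit B (_∈ R′ ∷ L)
swap-peakPit {n} {B} {L} {R′ = R′} peakPit s = refine extend peakPit
  where
    extend : ∀ {π} {p q r : Fin n} → Triple B p q r → NeverAt π (_∈ L) p q r → ∃ λ π′ → NeverAt π′ (_∈ R′ ∷ L) p q r
    extend {π = π} t never with never-after-swap s t never
    ... | inj₁ ¬at             = π , NeverAt-∷ ¬at never
    ... | inj₂ (never′ , ¬at′) = opposite π , NeverAt-∷ ¬at′ never′

record AdjacentInversion (S : List (Fin n)) (T : Rel n) : Set where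
  constructor adjacent
  field
    prefix suffix : List (Fin n)
    upper lower   : Fin n
    split         : S ≡ prefix ++ upper ∷ lower ∷ suffix
    flipped       : T lower upper ≡ true

  swapped : List (Fin n)
  swapped = prefix ++ lower ∷ upper ∷ suffix

  upper-above-lower : above S upper lower ≡ true
  upper-above-lower = subst (λ S → above S upper lower ≡ true) (sym split) (above⁺ (Above-adjacent prefix))

adjacent-∷ : ∀ {s} → AdjacentInversion S T → AdjacentInversion (s ∷ S) T
adjacent-∷ {s = s} (adjacent xs ys x y refl Tyx) = adjacent (s ∷ xs) ys x y refl Tyx

retarget : (∀ {x y} → above S x y ≡ true → X y x ≡ true → T y x ≡ true) →
           AdjacentInversion S X → AdjacentInversion S T
retarget X⊆T inv = adjacent prefix suffix upper lower split (X⊆T upper-above-lower flipped)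
  where open AdjacentInversion inv

head-or-tail : ∀ {s s′ S″} → Unique (s ∷ s′ ∷ S″) → (∀ {w} → w ∈ s ∷ s′ ∷ S″ → w ∈ₛ B) → IsLinearOn B T →
               v ∈ s′ ∷ S″ → T v s ≡ true → T s′ s ≡ true ⊎ ∃ λ w → w ∈ S″ × T w s′ ≡ true
head-or-tail {T = T} {s = s} {s′} (s∉ ∷ s′∉ ∷ _) inB T-lin v∈ Tvs with T s′ s in Ts′s | v∈
... | true  | _          = inj₁ refl
... | false | here refl  = ⊥-elim (true≢false Tvs Ts′s)
... | false | there v∈S″ with total T-lin (inB (there (here refl))) (inB (there (there v∈S″))) (All.lookup s′∉ v∈S″)
...   | inj₂ Tvs′ = inj₂ (_ , v∈S″ , Tvs′)
...   | inj₁ Ts′v =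
  let Tss′ = complete T-lin (inB (there (here refl))) (inB (here refl)) (All.head s∉ ∘ sym) Ts′s
  in ⊥-elim (true≢false (trans T-lin Tss′ Ts′v) (asym T-lin Tvs))

adjacent-inversion : Unique S → (∀ {w} → w ∈ S → w ∈ₛ B) → IsLinearOn B T →
                     Above S u v → T v u ≡ true → AdjacentInversion S T
adjacent-inversion (_ ∷ uq) inB T-lin (there p) Tvu = adjacent-∷ (adjacent-inversion uq (inB ∘ there) T-lin p Tvu)
adjacent-inversion {S = _ ∷ []} _ _ _ (here ()) _
adjacent-inversion {S = s ∷ s′ ∷ S″} uq@(_ ∷ uq′) inB T-lin (here v∈) Tvs with head-or-tail uq inB T-lin v∈ Tvs
... | inj₁ Ts′s            = adjacent [] S″ s s′ refl Ts′s
... | inj₂ (_ , w∈ , Tws′) = adjacent-∷ (adjacent-inversion uq′ (inB ∘ there) T-lin (here w∈) Tws′)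

median-at-endpoint : IsLinearOn B R → IsLinearOn B T → IsLinearOn B X →
                     ¬ (Inversion R X × Inversion T X) → X ≗₂ R ⊎ X ≗₂ T
median-at-endpoint R-lin T-lin X-lin ¬both with inversion? _ _
... | no ¬R  = inj₁ λ u v → sym (no-inversion⇒≗₂ R-lin X-lin ¬R u v)
... | yes iR = inj₂ λ u v → sym (no-inversion⇒≗₂ T-lin X-lin (λ iT → ¬both (iR , iT)) u v)

PeakPitSwap : Subset n → List (Rel n) → List (Fin n) → Rel n → Set
PeakPitSwap B L S T = Σ (AdjacentInversion S T) λ inv → IsPeakPit B (_∈ above (AdjacentInversion.swapped inv) ∷ L)

peakPit-swap : ∀ {n} {B : Subset n} {L S T} → Acc _<_ (dist (above S) T) →
               IsPeakPit B (_∈ L) → (_∈ L) ⊆ IsLinearOn B → IsLinOrd B S → above S ∈ L → T ∈ L →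
               Inversion (above S) T → PeakPitSwap B L S T
peakPit-swap {B = B} {L} {S} {T} (acc rec) peakPit linear S-lin@(uq , mem) S∈ T∈ (_ , _ , Ruv , Tvu)
  with Any.any? (λ Q → inversion? (above S) (med (above S) T Q) ×-dec inversion? T (med (above S) T Q)) L
... | yes between = toward-median (find between)
  where
    toward-median : ∃ (λ Q → Q ∈ L × Inversion (above S) (med (above S) T Q) × Inversion T (med (above S) T Q)) →
                    PeakPitSwap B L S T
    toward-median (Q , Q∈ , invSM , invTM) =
      let M-lin = med-linear peakPit linear S∈ T∈ Q∈
          inv , peakPit′ = peakPit-swap (rec (med-closer (linear S∈) (linear T∈) M-lin invTM))
                             (med-peakPit peakPit S∈ T∈ Q∈) (∷-linear M-lin linear) S-lin (there S∈) (here refl) invSM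
      in retarget (med-toward {T = T} {Q = Q} (linear S∈)) inv , IsPeakPit-⊆ (∷⁺ʳ _ (xs⊆x∷xs L _)) peakPit′
... | no none with adjacent-inversion uq (to (mem _)) (linear T∈) (above⁻ Ruv) Tvu
...   | inv@(adjacent xs ys x y refl Tyx) = inv , swap-peakPit peakPit record
  { R-linear  = linear S∈
  ; T-linear  = linear T∈
  ; R∈        = S∈
  ; T∈        = T∈
  ; T-yx      = Tyx
  ; reversal  = swap-reversal xs uq
  ; endpoints = λ Q∈ → median-at-endpoint (linear S∈) (linear T∈) (med-linear peakPit linear S∈ T∈ Q∈)
                                          (none ∘ lose Q∈)
  }

-- Geodesics

walk-length : {S T : Order {n}} → Walk S T P → All (IsLinOrd B) P → suc (dist (above S) (above T)) ≤ length P
walk-length {S = S} here ((uq , _) ∷ []) =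
  s≤s (≤-reflexive (count₂-none (inverted? (above S) (above S)) λ _ _ (p , q) → Above-asym uq (above⁻ p) (above⁻ q)))
walk-length {T = T} (step (xs , ys , a , b , refl , refl) w) (_ ∷ lins) =
  s≤s (≤-trans (count₂-≤-suc (inverted? _ (above T)) (inverted? _ (above T)) moved) (walk-length w lins))
  where
    moved : ∀ {s t} → Inverted (above (xs ++ a ∷ b ∷ ys)) (above T) s t →
            (s ≡ a × t ≡ b) ⊎ Inverted (above (xs ++ b ∷ a ∷ ys)) (above T) s t
    moved (p , q) = Sum.map₂ (λ p′ → above⁺ p′ , q) (Above-swap xs (above⁻ p))

Connection : Subset n → List (Rel n) → Order {n} → Order {n} → Set
Connection B L S T = ∃ λ P → PathIn B S T P × length P ≤ suc (dist (above S) (above T)) ×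
                             IsPeakPit B ((_∈ L) ∪ (_∈ map above P))

connect-refl : IsLinOrd B S → above S ∈ L → IsPeakPit B (_∈ L) → Connection B L S S
connect-refl S-lin S∈ peakPit = _ , (here , S-lin ∷ []) , s≤s z≤n , IsPeakPit-⊆ [ id , (λ { (here refl) → S∈ }) ]′ peakPit

Connection-∷ : ∀ xs {T} → IsLinOrd B (xs ++ x ∷ y ∷ ys) → above (xs ++ x ∷ y ∷ ys) ∈ L →
               dist (above (xs ++ y ∷ x ∷ ys)) (above T) < dist (above (xs ++ x ∷ y ∷ ys)) (above T) →
               Connection B (above (xs ++ y ∷ x ∷ ys) ∷ L) (xs ++ y ∷ x ∷ ys) T →
               Connection B L (xs ++ x ∷ y ∷ ys) T
Connection-∷ {x = x} {y} {ys} {L = L} xs S-lin S∈ closer (P , (walk , lins) , short , peakPit) =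
  _ ∷ P , (step (xs , ys , x , y , refl , refl) walk , S-lin ∷ lins) , s≤s (≤-trans short closer) ,
  IsPeakPit-⊆ grow peakPit
  where
    grow : (_∈ L) ∪ (_∈ map above ((xs ++ x ∷ y ∷ ys) ∷ P)) ⊆ (_∈ above (xs ++ y ∷ x ∷ ys) ∷ L) ∪ (_∈ map above P)
    grow (inj₁ X∈)          = inj₁ (there X∈)
    grow (inj₂ (here refl)) = inj₁ (there S∈)
    grow (inj₂ (there X∈))  = inj₂ X∈

no-inversion⇒≡ : IsLinOrd B S → IsLinOrd B S′ → ¬ Inversion (above S) (above S′) → S ≡ S′
no-inversion⇒≡ (uq , mem) (uq′ , mem′) none =
  same-order uq uq′ (from (mem′ _) ∘ to (mem _)) (from (mem _) ∘ to (mem′ _)) λ p q → none (_ , _ , above⁺ p , above⁺ q)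

connect : {S T : Order {n}} → Acc _<_ (dist (above S) (above T)) → IsPeakPit B (_∈ L) → (_∈ L) ⊆ IsLinearOn B →
          IsLinOrd B S → IsLinOrd B T → above S ∈ L → above T ∈ L → Connection B L S T
connect {S = S} {T} (acc rec) peakPit linear S-lin T-lin S∈ T∈ with inversion? (above S) (above T)
... | no none = subst (Connection _ _ S) (no-inversion⇒≡ S-lin T-lin none) (connect-refl S-lin S∈ peakPit)
... | yes inv with peakPit-swap (<-wellFounded _) peakPit linear S-lin S∈ T∈ inv
...   | adjacent xs ys x y refl Tyx , peakPit′ =
  Connection-∷ xs S-lin S∈ closer
    (connect (rec closer) peakPit′ (∷-linear (above-linear S′-lin) linear) S′-lin T-lin (here refl) (there T∈))
  where
    closer = reversal-closer (swap-reversal xs (proj₁ S-lin)) (linear T∈) Tyx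
    S′-lin = IsLinOrd-swap xs S-lin

Within : List (Fin n) → Fin n → Fin n → Fin n → Set
Within F x y z = ∀ {w} → w ∈ F → InTriple x y z w

InTriple-swap : InTriple x y z w → InTriple x z y w
InTriple-swap = [ inj₁ , [ inj₂ ∘ inj₂ , inj₂ ∘ inj₁ ]′ ]′

InTriple-rotate : IsRotation a b c x y z → InTriple a b c w → InTriple x y z w
InTriple-rotate rot₀ = id
InTriple-rotate rot₁ = [ inj₂ ∘ inj₂ , [ inj₁ , inj₂ ∘ inj₁ ]′ ]′
InTriple-rotate rot₂ = [ inj₂ ∘ inj₁ , [ inj₂ ∘ inj₂ , inj₁ ]′ ]′

rotation-InTriple : IsRotation a b c x y z → InTriple a b c x × InTriple a b c y × InTriple a b c z
rotation-InTriple rot₀ = inj₁ refl , inj₂ (inj₁ refl) , inj₂ (inj₂ refl)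
rotation-InTriple rot₁ = inj₂ (inj₁ refl) , inj₂ (inj₂ refl) , inj₁ refl
rotation-InTriple rot₂ = inj₂ (inj₂ refl) , inj₁ refl , inj₂ (inj₁ refl)

nth-top⇒ : nth F 0 ≡ just x → y ∈ F → y ≢ x → Above F x y
nth-top⇒ {F = _ ∷ _} refl y∈ y≢x = here (∈-tail y∈ y≢x)

nth-top⇐ : Unique F → Within F x y z → Above F x y → Above F x z → nth F 0 ≡ just x
nth-top⇐ {F = _ ∷ _} uq within xy xz with within (here refl)
... | inj₁ refl        = refl
... | inj₂ (inj₁ refl) = ⊥-elim (Above-¬head uq xy)
... | inj₂ (inj₂ refl) = ⊥-elim (Above-¬head uq xz)

nth-bottom⇒ : Unique F → Within F x y z → nth F 2 ≡ just x → Above F y x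
nth-bottom⇒ {F = _ ∷ _ ∷ _ ∷ _} (f₀∉ ∷ f₁∉ ∷ _) within refl with within (here refl) | within (there (here refl))
... | inj₂ (inj₁ refl) | _                = here (there (here refl))
... | _                | inj₂ (inj₁ refl) = there (here (here refl))
... | inj₁ refl        | _                = ⊥-elim (All.lookup f₀∉ (there (here refl)) refl)
... | _                | inj₁ refl        = ⊥-elim (All.head f₁∉ refl)
... | inj₂ (inj₂ refl) | inj₂ (inj₂ refl) = ⊥-elim (All.head f₀∉ refl)

nth-second : Unique F → (∀ {w} → w ∈ F → w ≡ x ⊎ w ≡ z) → Above F z x → nth F 1 ≡ just x
nth-second {F = _ ∷ []} _ _ (here ())
nth-second {F = _ ∷ []} _ _ (there ())
nth-second {F = _ ∷ _ ∷ _} uq@(f₁∉ ∷ _) within zx with within (here refl) | within (there (here refl))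
... | inj₁ refl | _         = ⊥-elim (Above-¬head uq zx)
... | inj₂ refl | inj₁ refl = refl
... | inj₂ refl | inj₂ refl = ⊥-elim (All.head f₁∉ refl)

nth-bottom-tail : ∀ {f₀} → Unique (f₀ ∷ F) → Within F x f₀ z → z ≢ f₀ → Above (f₀ ∷ F) z x → nth (f₀ ∷ F) 2 ≡ just x
nth-bottom-tail _ _ z≢f₀ (here _) = ⊥-elim (z≢f₀ refl)
nth-bottom-tail {F = F} {x = x} {z = z} (f₀∉ ∷ uq) within _ (there zx) = nth-second uq within′ zx
  where
    within′ : ∀ {w} → w ∈ F → w ≡ x ⊎ w ≡ z
    within′ w∈ = [ inj₁ , [ (λ w≡f₀ → ⊥-elim (All.lookup f₀∉ w∈ (sym w≡f₀))) , inj₂ ]′ ]′ (within w∈)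

nth-bottom⇐ : Unique F → Within F x y z → y ≢ z → Above F y x → Above F z x → nth F 2 ≡ just x
nth-bottom⇐ {F = _ ∷ _} uq within y≢z yx zx with within (here refl)
... | inj₁ refl        = ⊥-elim (Above-¬head uq yx)
... | inj₂ (inj₁ refl) = nth-bottom-tail uq (within ∘ there) (y≢z ∘ sym) zx
... | inj₂ (inj₂ refl) = nth-bottom-tail uq (InTriple-swap ∘ within ∘ there) y≢z yx

position : Pole → ℕ
position top    = 0
position bottom = 2

module _ {a b c x y z : Fin n} (ρ : IsRotation a b c x y z) where

  private
    inTriple? = λ w → (w ≟ a) ⊎-dec ((w ≟ b) ⊎-dec (w ≟ c))
    x∈ = proj₁ (rotation-InTriple ρ)
    y∈ = proj₁ (proj₂ (rotation-InTriple ρ))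
    z∈ = proj₂ (proj₂ (rotation-InTriple ρ))

    within : ∀ S → Within (restrict3 a b c S) x y z
    within S = InTriple-rotate ρ ∘ proj₂ ∘ ∈-filter⁻ inTriple? {xs = S}

    restrict3⁻ : ∀ S → Above (restrict3 a b c S) u v → Above S u v
    restrict3⁻ S = Above-filter⁻ inTriple? {ws = S}

    restrict3⁺ : ∀ S → InTriple a b c u → InTriple a b c v → Above S u v → Above (restrict3 a b c S) u v
    restrict3⁺ S = Above-filter⁺ inTriple? {ws = S}

  nth⇒AtPole : Triple B x y z → IsLinOrd B S → nth (restrict3 a b c S) (position π) ≡ just x →
               AtPole π (above S) x y z
  nth⇒AtPole {S = S} {π = top} (_ , y∈B , z∈B , x≢y , x≢z , _) (_ , mem) e =
    above⁺ (restrict3⁻ S (nth-top⇒ e (∈-filter⁺ inTriple? (from (mem _) y∈B) y∈) (x≢y ∘ sym))) ,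
    above⁺ (restrict3⁻ S (nth-top⇒ e (∈-filter⁺ inTriple? (from (mem _) z∈B) z∈) (x≢z ∘ sym)))
  nth⇒AtPole {S = S} {π = bottom} _ (uq , _) e =
    above⁺ (restrict3⁻ S (nth-bottom⇒ (filter⁺ inTriple? uq) (within S) e)) ,
    above⁺ (restrict3⁻ S (nth-bottom⇒ (filter⁺ inTriple? uq) (InTriple-swap ∘ within S) e))

  AtPole⇒nth : y ≢ z → Unique S → AtPole π (above S) x y z → nth (restrict3 a b c S) (position π) ≡ just x
  AtPole⇒nth {S = S} {π = top} _ uq (xy , xz) =
    nth-top⇐ (filter⁺ inTriple? uq) (within S) (restrict3⁺ S x∈ y∈ (above⁻ xy)) (restrict3⁺ S x∈ z∈ (above⁻ xz))
  AtPole⇒nth {S = S} {π = bottom} y≢z uq (yx , zx) =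
    nth-bottom⇐ (filter⁺ inTriple? uq) (within S) y≢z (restrict3⁺ S y∈ x∈ (above⁻ yx)) (restrict3⁺ S z∈ x∈ (above⁻ zx))

functions : ∀ m → List A → List (Fin m → A)
functions zero    as = Vector.[] ∷ []
functions (suc m) as = cartesianProductWith Vector._∷_ as (functions m as)

functions-complete : ∀ m {as : List A} (f : Fin m → A) → (∀ i → f i ∈ as) → ∃ λ g → g ∈ functions m as × g ≗ f
functions-complete zero    f _  = Vector.[] , here refl , λ ()
functions-complete (suc m) f f∈ with functions-complete m (f ∘ suc) (f∈ ∘ suc)
... | g , g∈ , g≗ = f zero Vector.∷ g , ∈-cartesianProductWith⁺ Vector._∷_ (f∈ zero) g∈ , λ { zero → refl ; (suc i) → g≗ i }

relations : ∀ n → List (Rel n)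
relations n = functions n (functions n (true ∷ false ∷ []))

relations-complete : (X : Rel n) → ∃ λ G → G ∈ relations n × G ≗₂ X
relations-complete {n} X =
  let G , G∈ , G≗ = functions-complete n (proj₁ ∘ row) (proj₁ ∘ proj₂ ∘ row)
  in G , G∈ , λ u v → ≡.trans (cong-app (G≗ u) v) (proj₂ (proj₂ (row u)) v)
  where
    bool∈ : ∀ α → α ∈ true ∷ false ∷ []
    bool∈ true  = here refl
    bool∈ false = there (here refl)
    row = λ u → functions-complete n (X u) (bool∈ ∘ X u)

isLinearOn? : ∀ B (X : Rel n) → Dec (IsLinearOn B X)
isLinearOn? B X = map′ fromFields toFields (support? ×-dec asym? ×-dec total? ×-dec trans?)
  where
    Support = ∀ u v → X u v ≡ true → u ∈ₛ B × v ∈ₛ B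
    Asym    = ∀ u v → X u v ≡ true → X v u ≡ false
    Total   = ∀ u v → u ∈ₛ B → v ∈ₛ B → u ≢ v → X u v ≡ true ⊎ X v u ≡ true
    Trans   = ∀ u v w → X u v ≡ true → X v w ≡ true → X u w ≡ true
    support? : Dec Support
    support? = all? λ u → all? λ v → (X u v Bool.≟ true) →-dec ((u ∈ₛ? B) ×-dec (v ∈ₛ? B))
    asym? : Dec Asym
    asym? = all? λ u → all? λ v → (X u v Bool.≟ true) →-dec (X v u Bool.≟ false)
    total? : Dec Total
    total? = all? λ u → all? λ v → (u ∈ₛ? B) →-dec (v ∈ₛ? B) →-dec ¬? (u ≟ v) →-dec
                                     ((X u v Bool.≟ true) ⊎-dec (X v u Bool.≟ true))
    trans? : Dec Trans
    trans? = all? λ u → all? λ v → all? λ w → (X u v Bool.≟ true) →-dec (X v w Bool.≟ true) →-dec (X u w Bool.≟ true)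
    fromFields : Support × Asym × Total × Trans → IsLinearOn B X
    fromFields (s , a , t , tr) = record { support = s _ _ ; asym = a _ _ ; total = t _ _ ; trans = tr _ _ _ }
    toFields : IsLinearOn B X → Support × Asym × Total × Trans
    toFields L = (λ _ _ → support L) , (λ _ _ → asym L) , (λ _ _ → total L) , (λ _ _ _ → trans L)

distinct? : (a b c : Fin n) → Dec (Distinct3 a b c)
distinct? a b c = ¬? (a ≟ b) ×-dec ¬? (a ≟ c) ×-dec ¬? (b ≟ c)

triple? : ∀ (B : Subset n) a b c → Dec (Triple B a b c)
triple? B a b c = (a ∈ₛ? B) ×-dec (b ∈ₛ? B) ×-dec (c ∈ₛ? B) ×-dec distinct? a b c

rotationAt : InTriple a b c x → ∃₂ λ y z → IsRotation a b c x y z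
rotationAt (inj₁ refl)        = _ , _ , rot₀
rotationAt (inj₂ (inj₁ refl)) = _ , _ , rot₁
rotationAt (inj₂ (inj₂ refl)) = _ , _ , rot₂

restrict-linear : IsLinOrd ⊤ S → IsLinOrd B (restrict B S)
restrict-linear {S = S} {B = B} (uq , mem) = filter⁺ (_∈ₛ? B) uq , λ a →
  mk⇔ (proj₂ ∘ ∈-filter⁻ (_∈ₛ? B) {xs = S}) (∈-filter⁺ (_∈ₛ? B) (from (mem a) ∈⊤))

restrict-never : IsLinOrd ⊤ S → IsRotation a b c x y z → Triple B x y z →
                 nth (restrict3 a b c S) (position π) ≢ just x → ¬ AtPole π (above (restrict B S)) x y z
restrict-never {S = S} {B = B} (uq , _) ρ (_ , _ , _ , _ , _ , y≢z) ¬nth =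
  ¬nth ∘ AtPole⇒nth ρ y≢z uq ∘ AtPole-⊑ (above⁺ {ws = S} ∘ Above-filter⁻ (_∈ₛ? B) {ws = S} ∘ above⁻ {ws = restrict B S})

atPosition : ∀ π → Never D a b c x (position π) → Never D a b c x 0 ⊎ Never D a b c x 2
atPosition top    = inj₁
atPosition bottom = inj₂

toPeakPit : ∀ {n} {B : Subset n} {D : Domain {n}} {E : Family n} →
            (∀ {S} → D S → IsLinOrd B S) → (∀ {S} → D S → ∃ λ X → E X × above S ⊑ X) →
            IsPeakPit B E → PeakPit B D
toPeakPit {B = B} {D = D} linear represent peakPit = (λ _ → linear) , λ _ _ _ a∈ b∈ c∈ d → triple (a∈ , b∈ , c∈ , d)
  where
    triple : ∀ {a b c} → Triple B a b c → ∃ λ x → InTriple a b c x × (Never D a b c x 0 ⊎ Never D a b c x 2)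
    triple t with peakPit t
    ... | never-at ρ π , never = _ , proj₁ (rotation-InTriple ρ) , atPosition π λ S S∈ e →
      let X , X∈ , S⊑X = represent S∈ in never X∈ (AtPole-⊑ S⊑X (nth⇒AtPole ρ (Triple-rotate ρ t) (linear S∈) e))

module FromDomain {n} (D : Domain {n}) (peakPit : PeakPit ⊤ D) (B : Subset n) where

  -- a never-condition satisfied by D on each triple; it is chosen without reference to a proof of
  -- distinctness, so that obeying all of them is decidable, and is arbitrary on other triples
  chosen : ∀ a b c → NeverCondition a b c
  chosen a b c with distinct? a b c
  ... | no _  = never-at rot₀ top
  ... | yes d with proj₂ peakPit a b c ∈⊤ ∈⊤ ∈⊤ d
  ...   | _ , x∈ , never = never-at (proj₂ (proj₂ (rotationAt x∈))) ([ const top , const bottom ]′ never)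

  Obeys : Rel n → Set
  Obeys X = ∀ a b c → Triple B a b c → ¬ Violates X (chosen a b c)

  obeys? : ∀ X → Dec (Obeys X)
  obeys? X = all? λ a → all? λ b → all? λ c → triple? B a b c →-dec ¬? (violates? X (chosen a b c))

  obeying-peakPit : (∀ {X} → E X → Obeys X) → IsPeakPit B E
  obeying-peakPit obeys {a} {b} {c} t = chosen a b c , λ X∈ → obeys X∈ a b c t

  restriction-linear : D S → IsLinOrd B (restrict B S)
  restriction-linear S∈ = restrict-linear (proj₁ peakPit _ S∈)

  restriction-obeys : D S → Obeys (above (restrict B S))
  restriction-obeys {S} S∈ a b c t with distinct? a b c
  ... | no ¬d = ⊥-elim (¬d (proj₂ (proj₂ (proj₂ t))))
  ... | yes d with proj₂ peakPit a b c ∈⊤ ∈⊤ ∈⊤ d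
  ...   | _ , x∈ , inj₁ never = restrict-never (proj₁ peakPit S S∈) ρ (Triple-rotate ρ t) (never S S∈)
    where ρ = proj₂ (proj₂ (rotationAt x∈))
  ...   | _ , x∈ , inj₂ never = restrict-never (proj₁ peakPit S S∈) ρ (Triple-rotate ρ t) (never S S∈)
    where ρ = proj₂ (proj₂ (rotationAt x∈))

  Admissible : Rel n → Set
  Admissible X = IsLinearOn B X × Obeys X

  admissible? : ∀ X → Dec (Admissible X)
  admissible? X = isLinearOn? B X ×-dec obeys? X

  -- D need not be decidable, but the step lemma has to search the family it works in,
  -- so D_B is covered by the finite list of all admissible relations
  candidates : List (Rel n)
  candidates = filter admissible? (relations n)

  candidate⁻ : X ∈ candidates → Admissible X
  candidate⁻ = proj₂ ∘ ∈-filter⁻ admissible? {xs = relations n}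

  candidate⁺ : Admissible X → ∃ λ G → G ∈ candidates × X ⊑ G
  candidate⁺ {X} (X-lin , X-obeys) =
    let G , G∈ , G≗X = relations-complete X
    in G , ∈-filter⁺ admissible? G∈ (IsLinearOn-≗₂ (λ u v → sym (G≗X u v)) X-lin ,
                                     λ a b c t → X-obeys a b c t ∘ Violates-⊑ {κ = chosen a b c} (≡.trans (sym (G≗X _ _))))
         , ≡.trans (G≗X _ _)

  restriction-admissible : D S → Admissible (above (restrict B S))
  restriction-admissible S∈ = above-linear (restriction-linear S∈) , restriction-obeys S∈

  initial : Order {n} → Order {n} → List (Rel n)
  initial R T = above (restrict B R) ∷ above (restrict B T) ∷ candidates

  initial-admissible : {R T : Order {n}} → D R → D T → X ∈ initial R T → Admissible X
  initial-admissible R∈ _  (here refl)         = restriction-admissible R∈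
  initial-admissible _  T∈ (there (here refl)) = restriction-admissible T∈
  initial-admissible _  _  (there (there X∈))  = candidate⁻ X∈

  extended-linear : All (IsLinOrd B) P → (restrictDom B D ∪L P) S → IsLinOrd B S
  extended-linear _    (inj₁ (_ , S∈ , refl)) = restriction-linear S∈
  extended-linear lins (inj₂ S∈P)             = All.lookup lins S∈P

  extended-represented : {R T : Order {n}} → (restrictDom B D ∪L P) S →
                         ∃ λ X → ((_∈ initial R T) ∪ (_∈ map above P)) X × above S ⊑ X
  extended-represented (inj₁ (_ , S∈ , refl)) =
    let G , G∈ , S⊑G = candidate⁺ (restriction-admissible S∈) in G , inj₁ (there (there G∈)) , S⊑G
  extended-represented (inj₂ S∈P) = _ , inj₂ (∈-map⁺ above S∈P) , id

proposition1 : (n : ℕ) (D : Domain {n}) → PeakPit ⊤ D →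
    (R T : Order {n}) → D R → D T →
    (B : Subset n) → 3 ≤ ∣ B ∣ →
    ∃ λ P → Geodesic B (restrict B R) (restrict B T) P ×
    PeakPit B (restrictDom B D ∪L P)
proposition1 n D peakPit R T R∈ T∈ B _ =
  let P , path , short , peakPit′ = connect (<-wellFounded _) (obeying-peakPit (proj₂ ∘ admissible))
                                            (proj₁ ∘ admissible) (restriction-linear R∈) (restriction-linear T∈)
                                            (here refl) (there (here refl))
  in P , (path , λ _ (walk , lins) → ≤-trans short (walk-length walk lins)) ,
     toPeakPit (extended-linear (proj₂ path)) (extended-represented {R = R} {T = T}) peakPit′
  where
    open FromDomain D peakPit B
    admissible : ∀ {X} → X ∈ initial R T → Admissible X
    admissible = initial-admissible R∈ T∈
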